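{- Let $r$ be a positive integer and let $W_r$ be the $r$-grid. Let $(A,B)$ be any separation in the natural tangle of $W_r$, and let $s:=|A\cap B|$ be its order. Then $|A|\leq s^2$.
   Context: The $r$-grid $W_r$ has vertex set $\{(i,j):1\le i,j\le r\}$, with $(i,j)$ and $(i',j')$ adjacent iff $|i-i'|+|j-j'|=1$. The $i$th row is $\{i\}\times\{1,\dots,r\}$ and the $j$th column is $\{1,\dots,r\}\times\{j\}$; the union of any row with any column is a cross. A separation of a graph $G$ is a pair $(A,B)$ of vertex sets with $A\cup B=V(G)$ and no edge between $A\setminus B$ and $B\setminus A$; its order is $|A\cap B|$. The natural tangle of $W_r$ is the set of all separations $(A,B)$ of $W_r$ of order less than $r$ such that $B$ contains (the vertex set of) a cross. -}

module Defs where

open import Data.Nat using (ℕ; suc; _+_; _<_; _≤_; _*_; ∣_-_∣)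
open import Data.Fin using (Fin; toℕ)
open import Data.Bool using (Bool; true; false; _∧_)
open import Data.List using (List; allFin; cartesianProduct; filter; length)
open import Data.Product using (_×_; _,_; Σ; ∃₂)
open import Data.Sum using (_⊎_)
open import Relation.Binary.PropositionalEquality using (_≡_)
open import Relation.Nullary using (¬_)
import Data.Empty
open import Data.Bool.Properties using (T?)
open import Data.Bool using (T)

-- Vertices of the r-grid W_r: pairs (i , j) with i , j ∈ Fin r
-- (Fin r = {0,…,r-1} stands for {1,…,r}).
Vertex : ℕ → Set
Vertex r = Fin r × Fin r

VSet : ℕ → Set
VSet r = Vertex r → Bool

Adjacent : ∀ {r} → Vertex r → Vertex r → Set
Adjacent (i , j) (i' , j') = ∣ toℕ i - toℕ i' ∣ + ∣ toℕ j - toℕ j' ∣ ≡ 1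

vertices : (r : ℕ) → List (Vertex r)
vertices r = cartesianProduct (allFin r) (allFin r)

∣_∣ᵥ : ∀ {r} → VSet r → ℕ
∣_∣ᵥ {r} X = length (filter (λ v → T? (X v)) (vertices r))

_∩ᵥ_ : ∀ {r} → VSet r → VSet r → VSet r
(X ∩ᵥ Y) v = X v ∧ Y v

record IsSeparation {r : ℕ} (A B : VSet r) : Set where
  field
    covers : ∀ v → A v ≡ true ⊎ B v ≡ true
    noEdge : ∀ u v → Adjacent u v →
             A u ≡ true → B u ≡ false →
             B v ≡ true → A v ≡ false → Data.Empty.⊥

order : ∀ {r} → VSet r → VSet r → ℕ
order A B = ∣ A ∩ᵥ B ∣ᵥ

ContainsCross : ∀ {r} → VSet r → Fin r → Fin r → Set
ContainsCross {r} B i j = (∀ k → B (i , k) ≡ true) × (∀ k → B (k , j) ≡ true)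

InNaturalTangle : (r : ℕ) → VSet r → VSet r → Set
InNaturalTangle r A B =
  IsSeparation A B × order A B < r × ∃₂ (λ i j → ContainsCross B i j)

-- Every vertex of A lies in a row and in a column that meet A. Such a row
-- also meets the column of the cross in B, so walking along the row from A
-- to B one must pass through A ∩ B; hence at most s rows meet A, likewise at
-- most s columns, and |A| ≤ s².
module Submission where

open import Defs
open import Data.Nat using (ℕ; suc; _+_; _*_; _≤_; z≤n; s≤s; NonZero; ∣_-_∣)
open import Data.Nat.Properties
  using ( +-assoc; +-comm; +-identityʳ; *-zeroʳ; *-distribˡ-+; *-distribʳ-+; ≤-refl; ≤-trans
        ; +-mono-≤; *-mono-≤; ∣-∣-comm; ∣n-n∣≡0; ∣m-m+n∣≡n; +-commutativeSemigroup; module ≤-Reasoning)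
open import Data.Fin using (Fin; zero; suc; toℕ; inject₁)
open import Data.Fin.Properties using (toℕ-inject₁)
open import Data.Bool using (Bool; true; false; _∧_)
open import Data.Bool.Properties using (T?; T-≡)
open import Data.List using (List; []; _∷_; _++_; map; allFin; cartesianProduct; filter; length)
open import Data.Bool.ListAction using (any)
open import Data.List.Membership.Propositional using (_∈_; lose)
open import Data.List.Membership.Propositional.Properties using (∈-allFin)
open import Data.List.Relation.Unary.Any using (satisfied)
open import Data.List.Relation.Unary.Any.Properties using (any⁺; any⁻)
open import Data.Product using (_×_; _,_; ∃)
import Data.Product as Product
open import Data.Sum using (_⊎_; inj₁; inj₂)
open import Data.Empty using (⊥; ⊥-elim)
open import Function using (_∘_; Equivalence)
open import Relation.Binary.PropositionalEquality
open import Algebra.Properties.CommutativeSemigroup +-commutativeSemigroup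
  using () renaming (interchange to +-interchange)
open import Relation.Binary.Construct.Closure.ReflexiveTransitive using (Star; ε; _◅_; _◅◅_; gmap; reverse)

∑ : {X : Set} → List X → (X → ℕ) → ℕ
∑ []       f = 0
∑ (x ∷ xs) f = f x + ∑ xs f

syntax ∑ xs (λ x → f) = ∑[ x ∈ xs ] f

module _ {X : Set} where

  ∑-mono-≤ : (xs : List X) {f g : X → ℕ} → (∀ x → f x ≤ g x) → ∑ xs f ≤ ∑ xs g
  ∑-mono-≤ []       f≤g = z≤n
  ∑-mono-≤ (x ∷ xs) f≤g = +-mono-≤ (f≤g x) (∑-mono-≤ xs f≤g)

  ∑-zero : (xs : List X) → ∑[ x ∈ xs ] 0 ≡ 0
  ∑-zero []       = refl
  ∑-zero (x ∷ xs) = ∑-zero xs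

  ∑-cong : (xs : List X) {f g : X → ℕ} → (∀ x → f x ≡ g x) → ∑ xs f ≡ ∑ xs g
  ∑-cong []       f≡g = refl
  ∑-cong (x ∷ xs) f≡g = cong₂ _+_ (f≡g x) (∑-cong xs f≡g)

  ∑-+ : (xs : List X) (f g : X → ℕ) → ∑[ x ∈ xs ] (f x + g x) ≡ ∑ xs f + ∑ xs g
  ∑-+ []       f g = refl
  ∑-+ (x ∷ xs) f g =
    trans (cong (f x + g x +_) (∑-+ xs f g)) (+-interchange (f x) (g x) (∑ xs f) (∑ xs g))

  ∑-*ˡ : (xs : List X) (c : ℕ) (f : X → ℕ) → ∑[ x ∈ xs ] (c * f x) ≡ c * ∑ xs f
  ∑-*ˡ []       c f = sym (*-zeroʳ c)
  ∑-*ˡ (x ∷ xs) c f = trans (cong (c * f x +_) (∑-*ˡ xs c f)) (sym (*-distribˡ-+ c (f x) _))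

  ∑-*ʳ : (xs : List X) (f : X → ℕ) (c : ℕ) → ∑[ x ∈ xs ] (f x * c) ≡ ∑ xs f * c
  ∑-*ʳ []       f c = refl
  ∑-*ʳ (x ∷ xs) f c = trans (cong (f x * c +_) (∑-*ʳ xs f c)) (sym (*-distribʳ-+ c (f x) _))

  ∑-++ : (xs ys : List X) (f : X → ℕ) → ∑ (xs ++ ys) f ≡ ∑ xs f + ∑ ys f
  ∑-++ []       ys f = refl
  ∑-++ (x ∷ xs) ys f = trans (cong (f x +_) (∑-++ xs ys f)) (sym (+-assoc (f x) _ _))

∑-map : {X Y : Set} (g : X → Y) (xs : List X) (f : Y → ℕ) → ∑ (map g xs) f ≡ ∑[ x ∈ xs ] f (g x)
∑-map g []       f = refl
∑-map g (x ∷ xs) f = cong (f (g x) +_) (∑-map g xs f)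

∑-cartesianProduct : {X Y : Set} (xs : List X) (ys : List Y) (f : X × Y → ℕ) →
  ∑ (cartesianProduct xs ys) f ≡ ∑[ x ∈ xs ] ∑[ y ∈ ys ] f (x , y)
∑-cartesianProduct []       ys f = refl
∑-cartesianProduct (x ∷ xs) ys f =
  trans (∑-++ (map (x ,_) ys) _ f) (cong₂ _+_ (∑-map (x ,_) ys f) (∑-cartesianProduct xs ys f))

∑-comm : {X Y : Set} (xs : List X) (ys : List Y) (f : X → Y → ℕ) →
  ∑[ x ∈ xs ] ∑[ y ∈ ys ] f x y ≡ ∑[ y ∈ ys ] ∑[ x ∈ xs ] f x y
∑-comm []       ys f = sym (∑-zero ys)
∑-comm (x ∷ xs) ys f =
  trans (cong (∑ ys (f x) +_) (∑-comm xs ys f)) (sym (∑-+ ys (f x) (λ y → ∑[ x ∈ xs ] f x y)))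

∑-product : {X Y : Set} (xs : List X) (ys : List Y) (f : X → ℕ) (g : Y → ℕ) →
  ∑[ x ∈ xs ] ∑[ y ∈ ys ] (f x * g y) ≡ ∑ xs f * ∑ ys g
∑-product xs ys f g = trans (∑-cong xs (λ x → ∑-*ˡ ys (f x) g)) (∑-*ʳ xs f (∑ ys g))

𝟙 : Bool → ℕ
𝟙 true  = 1
𝟙 false = 0

𝟙-mono-≤ : {a b : Bool} → (a ≡ true → b ≡ true) → 𝟙 a ≤ 𝟙 b
𝟙-mono-≤ {false}         a⇒b = z≤n
𝟙-mono-≤ {true}  {true}  a⇒b = ≤-refl
𝟙-mono-≤ {true}  {false} a⇒b with () ← a⇒b refl

∧-intro : {a b : Bool} → a ≡ true → b ≡ true → a ∧ b ≡ true
∧-intro refl refl = refl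

𝟙-∧ : (a b : Bool) → 𝟙 (a ∧ b) ≡ 𝟙 a * 𝟙 b
𝟙-∧ false b = refl
𝟙-∧ true  b = sym (+-identityʳ (𝟙 b))

module _ {X : Set} (p : X → Bool) where

  length-filter≡∑𝟙 : (xs : List X) → length (filter (T? ∘ p) xs) ≡ ∑[ x ∈ xs ] 𝟙 (p x)
  length-filter≡∑𝟙 []       = refl
  length-filter≡∑𝟙 (x ∷ xs) with p x
  ... | true  = cong suc (length-filter≡∑𝟙 xs)
  ... | false = length-filter≡∑𝟙 xs

  𝟙-any≤∑𝟙 : (xs : List X) → 𝟙 (any p xs) ≤ ∑[ x ∈ xs ] 𝟙 (p x)
  𝟙-any≤∑𝟙 []       = z≤n
  𝟙-any≤∑𝟙 (x ∷ xs) with p x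
  ... | true  = s≤s z≤n
  ... | false = 𝟙-any≤∑𝟙 xs

  any-witness : (xs : List X) → any p xs ≡ true → ∃ λ x → p x ≡ true
  any-witness xs = Product.map₂ (Equivalence.to T-≡) ∘ satisfied ∘ any⁻ p xs ∘ Equivalence.from T-≡

  any-intro : {xs : List X} {x : X} → x ∈ xs → p x ≡ true → any p xs ≡ true
  any-intro x∈xs px = Equivalence.to T-≡ (any⁺ p (lose x∈xs (Equivalence.from T-≡ px)))

module _ {V : Set} (E : V → V → Set) (a b : V → Bool)
  (cover : ∀ v → a v ≡ true ⊎ b v ≡ true)
  (no-edge : ∀ u v → E u v → a u ≡ true → b u ≡ false → b v ≡ true → a v ≡ false → ⊥) where

  walk-meets-∩ : ∀ {u v} → Star E u v → a u ≡ true → b v ≡ true → ∃ λ w → a w ∧ b w ≡ true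
  walk-meets-∩ {u} ε au bu = u , ∧-intro au bu
  walk-meets-∩ {u} (_◅_ {j = u′} e walk) au bv with b u in bu
  ... | true  = u , ∧-intro au bu
  ... | false with a u′ in au′ | cover u′
  ...   | true  | _          = walk-meets-∩ walk au′ bv
  ...   | false | inj₁ ()
  ...   | false | inj₂ bu′   = ⊥-elim (no-edge u u′ e au bu bu′ au′)

Consecutive : ∀ {n} → Fin n → Fin n → Set
Consecutive k l = ∣ toℕ k - toℕ l ∣ ≡ 1

consecutive-sym : ∀ {n} (k l : Fin n) → Consecutive k l → Consecutive l k
consecutive-sym k l = trans (∣-∣-comm (toℕ l) (toℕ k))

walk-from-zero : ∀ {n} (l : Fin (suc n)) → Star Consecutive zero l
walk-from-zero zero            = ε
walk-from-zero {suc n} (suc l) =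
  gmap inject₁ (λ {k} {m} → inject₁-consecutive k m) (walk-from-zero l) ◅◅ (last-step ◅ ε)
  where
  inject₁-consecutive : (k m : Fin (suc n)) → Consecutive k m → Consecutive (inject₁ k) (inject₁ m)
  inject₁-consecutive k m rewrite toℕ-inject₁ k | toℕ-inject₁ m = λ c → c
  last-step : Consecutive (inject₁ l) (suc l)
  last-step rewrite toℕ-inject₁ l = trans (cong (∣_-_∣ (toℕ l)) (+-comm 1 (toℕ l))) (∣m-m+n∣≡n (toℕ l) 1)

consecutive-connected : ∀ {n} (k l : Fin n) → Star Consecutive k l
consecutive-connected {suc n} k l =
  reverse (λ {k} {l} → consecutive-sym k l) (walk-from-zero k) ◅◅ walk-from-zero l

row-adjacent : ∀ {r} (i : Fin r) (k l : Fin r) → Consecutive k l → Adjacent (i , k) (i , l)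
row-adjacent i k l c rewrite ∣n-n∣≡0 (toℕ i) = c

column-adjacent : ∀ {r} (j : Fin r) (k l : Fin r) → Consecutive k l → Adjacent (k , j) (l , j)
column-adjacent j k l c rewrite ∣n-n∣≡0 (toℕ j) | +-identityʳ ∣ toℕ k - toℕ l ∣ = c

rowMeets : ∀ {r} → VSet r → Fin r → Bool
rowMeets {r} X i = any (λ j → X (i , j)) (allFin r)

columnMeets : ∀ {r} → VSet r → Fin r → Bool
columnMeets {r} X j = any (λ i → X (i , j)) (allFin r)

module _ {r : ℕ} where

  private
    F : List (Fin r)
    F = allFin r

  ∣∣ᵥ≡∑∑ : (X : VSet r) → ∣ X ∣ᵥ ≡ ∑[ i ∈ F ] ∑[ j ∈ F ] 𝟙 (X (i , j))
  ∣∣ᵥ≡∑∑ X = trans (length-filter≡∑𝟙 X (vertices r)) (∑-cartesianProduct F F (𝟙 ∘ X))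

  ∣∣ᵥ≤rows*columns : (X : VSet r) →
    ∣ X ∣ᵥ ≤ (∑[ i ∈ F ] 𝟙 (rowMeets X i)) * (∑[ j ∈ F ] 𝟙 (columnMeets X j))
  ∣∣ᵥ≤rows*columns X = begin
    ∣ X ∣ᵥ                                                         ≡⟨ ∣∣ᵥ≡∑∑ X ⟩
    ∑[ i ∈ F ] ∑[ j ∈ F ] 𝟙 (X (i , j))                            ≤⟨ ∑-mono-≤ F (λ i → ∑-mono-≤ F (in-rows×columns i)) ⟩
    ∑[ i ∈ F ] ∑[ j ∈ F ] (𝟙 (rowMeets X i) * 𝟙 (columnMeets X j)) ≡⟨ ∑-product F F _ _ ⟩
    (∑[ i ∈ F ] 𝟙 (rowMeets X i)) * (∑[ j ∈ F ] 𝟙 (columnMeets X j)) ∎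
    where
    open ≤-Reasoning
    in-rows×columns : ∀ i j → 𝟙 (X (i , j)) ≤ 𝟙 (rowMeets X i) * 𝟙 (columnMeets X j)
    in-rows×columns i j =
      subst (𝟙 (X (i , j)) ≤_) (𝟙-∧ (rowMeets X i) (columnMeets X j)) (𝟙-mono-≤ λ xij →
        ∧-intro (any-intro (λ j → X (i , j)) (∈-allFin j) xij)
                (any-intro (λ i → X (i , j)) (∈-allFin i) xij))

  module _ {A B : VSet r} (sep : IsSeparation A B) where
    open IsSeparation sep

    line-meets-∩ : (e : Fin r → Vertex r) → (∀ k l → Consecutive k l → Adjacent (e k) (e l)) →
      ∀ {k l} → A (e k) ≡ true → B (e l) ≡ true → ∃ λ m → (A ∩ᵥ B) (e m) ≡ true
    line-meets-∩ e adjacent {k} {l} = walk-meets-∩ Consecutive (A ∘ e) (B ∘ e) (covers ∘ e)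
      (λ u v → noEdge (e u) (e v) ∘ adjacent u v) (consecutive-connected k l)

    rows≤order : ∀ {j₀} → (∀ i → B (i , j₀) ≡ true) → ∑[ i ∈ F ] 𝟙 (rowMeets A i) ≤ order A B
    rows≤order colB = begin
      ∑[ i ∈ F ] 𝟙 (rowMeets A i)                ≤⟨ ∑-mono-≤ F (λ i → 𝟙-mono-≤ (rowMeets-∩ i)) ⟩
      ∑[ i ∈ F ] 𝟙 (rowMeets (A ∩ᵥ B) i)         ≤⟨ ∑-mono-≤ F (λ i → 𝟙-any≤∑𝟙 _ F) ⟩
      ∑[ i ∈ F ] ∑[ j ∈ F ] 𝟙 ((A ∩ᵥ B) (i , j)) ≡⟨ ∣∣ᵥ≡∑∑ (A ∩ᵥ B) ⟨
      order A B                                  ∎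
      where
      open ≤-Reasoning
      rowMeets-∩ : ∀ i → rowMeets A i ≡ true → rowMeets (A ∩ᵥ B) i ≡ true
      rowMeets-∩ i meets =
        let (j , aij) = any-witness (λ j → A (i , j)) F meets
            (k , abik) = line-meets-∩ (i ,_) (row-adjacent i) aij (colB i)
        in any-intro (λ j → (A ∩ᵥ B) (i , j)) (∈-allFin k) abik

    columns≤order : ∀ {i₀} → (∀ j → B (i₀ , j) ≡ true) → ∑[ j ∈ F ] 𝟙 (columnMeets A j) ≤ order A B
    columns≤order rowB = begin
      ∑[ j ∈ F ] 𝟙 (columnMeets A j)             ≤⟨ ∑-mono-≤ F (λ j → 𝟙-mono-≤ (columnMeets-∩ j)) ⟩
      ∑[ j ∈ F ] 𝟙 (columnMeets (A ∩ᵥ B) j)      ≤⟨ ∑-mono-≤ F (λ j → 𝟙-any≤∑𝟙 _ F) ⟩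
      ∑[ j ∈ F ] ∑[ i ∈ F ] 𝟙 ((A ∩ᵥ B) (i , j)) ≡⟨ ∑-comm F F (λ i j → 𝟙 ((A ∩ᵥ B) (i , j))) ⟨
      ∑[ i ∈ F ] ∑[ j ∈ F ] 𝟙 ((A ∩ᵥ B) (i , j)) ≡⟨ ∣∣ᵥ≡∑∑ (A ∩ᵥ B) ⟨
      order A B                                  ∎
      where
      open ≤-Reasoning
      columnMeets-∩ : ∀ j → columnMeets A j ≡ true → columnMeets (A ∩ᵥ B) j ≡ true
      columnMeets-∩ j meets =
        let (i , aij) = any-witness (λ i → A (i , j)) F meets
            (k , abkj) = line-meets-∩ (_, j) (column-adjacent j) aij (rowB j)
        in any-intro (λ i → (A ∩ᵥ B) (i , j)) (∈-allFin k) abkj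

lemma1 : (r : ℕ) → .{{_ : NonZero r}} → (A B : VSet r) → InNaturalTangle r A B →
    ∣ A ∣ᵥ ≤ order A B * order A B
lemma1 r A B (sep , _ , _ , _ , rowB , colB) =
  ≤-trans (∣∣ᵥ≤rows*columns A) (*-mono-≤ (rows≤order sep colB) (columns≤order sep rowB))
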